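{- Let $L$ be any of the fifteen logics of the modal cube and $\mathcal M_L$ its Nmatrix. For every set of formulas $\Gamma$ and formula $\alpha$, if $\Gamma\models^{\mathcal M_L}\alpha$ then $\Gamma\vdash_L\alpha$.
   Context: Syntax and logics. Formulas: $\alpha ::= p \mid \bot \mid \alpha\to\alpha \mid \Box\alpha$; $\mathrm{For}$ is the set of formulas; $\neg\alpha:=\alpha\to\bot$, $\Diamond\alpha:=\neg\Box\neg\alpha$, $\wedge,\vee$ the usual classical abbreviations. $\mathbf K$: classical propositional axioms, (k) $\Box(\alpha\to\beta)\to(\Box\alpha\to\Box\beta)$, modus ponens, necessitation. Axiom schemes (D) $\Box\alpha\to\Diamond\alpha$, (T) $\Box\alpha\to\alpha$, (B) $\alpha\to\Box\Diamond\alpha$, (4) $\Box\alpha\to\Box\Box\alpha$, (5) $\Diamond\alpha\to\Box\Diamond\alpha$. The modal cube: $\mathbf K,\mathbf{KB},\mathbf{K4},\mathbf{K5},\mathbf{K45},\mathbf{KD},\mathbf{KDB},\mathbf{KD4},\mathbf{KD5},\mathbf{KD45},\mathbf{KT},\mathbf{KTB},\mathbf{S4}=\mathbf{KT4},\mathbf{S5}=\mathbf{KTB45},\mathbf{KB5}=\mathbf{KB45}$. $\Gamma\vdash_L\alpha$ means $\alpha$ or $(\gamma_1\wedge\dots\wedge\gamma_k)\to\alpha$ (some $\gamma_i\in\Gamma$) is a theorem of $L$. Truth values $\mathbf{F},\mathbf{f},\mathbf{f}_2,\mathbf{f}_3,\mathbf{t}_3,\mathbf{t}_2,\mathbf{t},\mathbf{T}$;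 designated set $\mathcal D=\{\mathbf T,\mathbf t,\mathbf t_2,\mathbf t_3\}$. Nmatrix $\mathcal M_L$. Values $V(L)$: all eight values for $\mathbf K,\mathbf{KB},\mathbf{K4},\mathbf{K5},\mathbf{K45}$; $\{\mathbf F,\mathbf f,\mathbf f_2,\mathbf t_2,\mathbf t,\mathbf T\}$ for $\mathbf{KB5}$; $\{\mathbf F,\mathbf f,\mathbf f_3,\mathbf t_3,\mathbf t,\mathbf T\}$ for $\mathbf{KD},\mathbf{KDB},\mathbf{KD4},\mathbf{KD5},\mathbf{KD45}$; $\{\mathbf F,\mathbf f,\mathbf t,\mathbf T\}$ for $\mathbf{KT},\mathbf{KTB},\mathbf{S4},\mathbf{S5}$. Designated values $V(L)\cap\mathcal D$. $\tilde\bot=\{\mathbf F,\mathbf f_2\}$. $\tilde\to(x,y)$, restricted to arguments in $V(L)$, listed for $y=\mathbf F,\mathbf f,\mathbf f_2,\mathbf f_3,\mathbf t_3,\mathbf t_2,\mathbf t,\mathbf T$: $x=\mathbf F$: $\{\mathbf T\}$ for all $y$; $x=\mathbf f$: $\{\mathbf t\},\{\mathbf T,\mathbf t\},\{\mathbf t_2\},\{\mathbf T\},\{\mathbf t\},\{\mathbf T\},\{\mathbf T,\mathbf t\},\{\mathbf T\}$; $x=\mathbf f_2$ and $x=\mathbf f_3$: $\{\mathbf t_3\},\{\mathbf t\},\{\mathbf t_2\},\{\mathbf T\},\{\mathbf t_3\},\{\mathbf t_2\},\{\mathbf t\},\{\mathbf T\}$; $x=\mathbf t_3$: $\{\mathbf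 f_3\}$ for $y\in\{\mathbf F,\mathbf f,\mathbf f_2,\mathbf f_3\}$, $\{\mathbf T\}$ otherwise; $x=\mathbf t_2$: $\{\mathbf F\},\{\mathbf f\},\{\mathbf f_2\},\{\mathbf f_3\},\{\mathbf t_3\},\{\mathbf t_2\},\{\mathbf t_3\},\{\mathbf T\}$; $x=\mathbf t$: $\{\mathbf f\},\{\mathbf f,\mathbf f_3\},\{\mathbf f_3\},\{\mathbf f_3\},\{\mathbf t\},\{\mathbf T\},\{\mathbf T,\mathbf t\},\{\mathbf T\}$; $x=\mathbf T$: $\{\mathbf F\},\{\mathbf f\},\{\mathbf f_2\},\{\mathbf f_3\},\{\mathbf t_3\},\{\mathbf t_2\},\{\mathbf t\},\{\mathbf T\}$. $\tilde\Box$ (argument $\mapsto$ output): $\mathbf K$: $\mathbf F,\mathbf f,\mathbf t_3,\mathbf t\mapsto\{\mathbf F,\mathbf f,\mathbf f_3\}$; $\mathbf f_2,\mathbf t_2\mapsto\{\mathbf t_2\}$; $\mathbf f_3,\mathbf T\mapsto\{\mathbf T,\mathbf t,\mathbf t_3\}$. $\mathbf{KB}$: $\mathbf F,\mathbf f\mapsto\{\mathbf F\}$; $\mathbf f_2,\mathbf t_2\mapsto\{\mathbf t_2\}$; $\mathbf f_3\mapsto\{\mathbf t_3\}$; $\mathbf t_3,\mathbf t\mapsto\{\mathbf F,\mathbf f,\mathbf f_3\}$; $\mathbf T\mapsto\{\mathbf T,\mathbf t,\mathbf t_3\}$. $\mathbf{K4}$: $\mathbf F,\mathbf f,\mathbf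 t_3,\mathbf t\mapsto\{\mathbf F,\mathbf f,\mathbf f_3\}$; $\mathbf f_2,\mathbf t_2\mapsto\{\mathbf t_2\}$; $\mathbf f_3,\mathbf T\mapsto\{\mathbf T\}$. $\mathbf{K5}$: $\mathbf F,\mathbf f,\mathbf t_3,\mathbf t\mapsto\{\mathbf F\}$; $\mathbf f_2,\mathbf t_2\mapsto\{\mathbf t_2\}$; $\mathbf f_3,\mathbf T\mapsto\{\mathbf T,\mathbf t_3\}$. $\mathbf{K45}$: $\mathbf F,\mathbf f,\mathbf t_3,\mathbf t\mapsto\{\mathbf F\}$; $\mathbf f_2,\mathbf t_2\mapsto\{\mathbf t_2\}$; $\mathbf f_3,\mathbf T\mapsto\{\mathbf T\}$. $\mathbf{KB5}$: $\mathbf F,\mathbf f,\mathbf t\mapsto\{\mathbf F\}$; $\mathbf f_2,\mathbf t_2\mapsto\{\mathbf t_2\}$; $\mathbf T\mapsto\{\mathbf T\}$. $\mathbf{KD}$: $\mathbf F,\mathbf f,\mathbf t_3,\mathbf t\mapsto\{\mathbf F,\mathbf f,\mathbf f_3\}$; $\mathbf f_3,\mathbf T\mapsto\{\mathbf T,\mathbf t,\mathbf t_3\}$. $\mathbf{KDB}$: $\mathbf F,\mathbf f\mapsto\{\mathbf F\}$; $\mathbf f_3\mapsto\{\mathbf t_3\}$; $\mathbf t_3,\mathbf t\mapsto\{\mathbf F,\mathbf f,\mathbf f_3\}$; $\mathbf T\mapsto\{\mathbf T,\mathbf t,\mathbf t_3\}$. $\mathbf{KD4}$: $\mathbf F,\mathbf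 t_3\mapsto\{\mathbf F\}$; $\mathbf f,\mathbf t\mapsto\{\mathbf F,\mathbf f,\mathbf f_3\}$; $\mathbf f_3,\mathbf T\mapsto\{\mathbf T\}$. $\mathbf{KD5}$: $\mathbf F,\mathbf f,\mathbf t_3,\mathbf t\mapsto\{\mathbf F\}$; $\mathbf f_3,\mathbf T\mapsto\{\mathbf T,\mathbf t_3\}$. $\mathbf{KD45}$: $\mathbf F,\mathbf f,\mathbf t_3,\mathbf t\mapsto\{\mathbf F\}$; $\mathbf f_3,\mathbf T\mapsto\{\mathbf T\}$. $\mathbf{KT}$: $\mathbf F\mapsto\{\mathbf F\}$; $\mathbf f,\mathbf t\mapsto\{\mathbf F,\mathbf f\}$; $\mathbf T\mapsto\{\mathbf T,\mathbf t\}$. $\mathbf{KTB}$: $\mathbf F,\mathbf f\mapsto\{\mathbf F\}$; $\mathbf t\mapsto\{\mathbf F,\mathbf f\}$; $\mathbf T\mapsto\{\mathbf T,\mathbf t\}$. $\mathbf{S4}$: $\mathbf F\mapsto\{\mathbf F\}$; $\mathbf f,\mathbf t\mapsto\{\mathbf F,\mathbf f\}$; $\mathbf T\mapsto\{\mathbf T\}$. $\mathbf{S5}$: $\mathbf F,\mathbf f,\mathbf t\mapsto\{\mathbf F\}$; $\mathbf T\mapsto\{\mathbf T\}$. A valuation in $\mathcal M_L$ is a map $v:\mathrm{For}\to V(L)$ with $v(\bot)\in\tilde\bot$, $v(\alpha\to\beta)\in\tilde\to(v(\alpha),v(\beta))$, $v(\Box\alpha)\in\tilde\Box(v(\alpha))$;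 $\mathrm{Val}(\mathcal M_L)$ is the set of valuations. Level valuations: $L_0(\mathcal M_L)$ is the set of $v\in\mathrm{Val}(\mathcal M_L)$ such that, if $v(\alpha)\in\{\mathbf f_2,\mathbf t_2\}$ for some $\alpha$, then $v(\beta)\in\{\mathbf f_2,\mathbf t_2\}$ for all $\beta$. $L_{n+1}(\mathcal M_L)=\{v\in L_n(\mathcal M_L)\mid$ for all $\alpha$, if $w(\alpha)\in\mathcal D$ for every $w\in L_n(\mathcal M_L)$, then $v(\alpha)\in\{\mathbf T,\mathbf t_2\}\}$. $L(\mathcal M_L)=\bigcap_{n\ge0}L_n(\mathcal M_L)$. $\Gamma\models^{\mathcal M_L}\alpha$ means: for every $v\in L(\mathcal M_L)$, if $v(\beta)\in\mathcal D$ for all $\beta\in\Gamma$ then $v(\alpha)\in\mathcal D$. -}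

module Defs where

open import Data.Nat using (ℕ; zero; suc)
open import Data.List using (List; []; _∷_)
open import Data.List.NonEmpty using (List⁺; _∷_; foldr₁)
open import Data.List.Membership.Propositional using (_∈_)
open import Data.List.NonEmpty.Relation.Unary.All as All⁺ using ()
open import Data.Product using (Σ; _×_)
open import Data.Sum using (_⊎_)
open import Data.Empty using (⊥)
open import Level using (0ℓ)
open import Relation.Unary using (Pred)

infixr 5 _⇒_
data Fm : Set where
  var  : ℕ → Fm
  ⊥'   : Fm
  _⇒_  : Fm → Fm → Fm
  □    : Fm → Fm

¬' : Fm → Fm
¬' α = α ⇒ ⊥'

◇ : Fm → Fm
◇ α = ¬' (□ (¬' α))

_∧'_ : Fm → Fm → Fm
α ∧' β = ¬' (α ⇒ ¬' β)

⋀ : List⁺ Fm → Fm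
⋀ = foldr₁ _∧'_

data Logic : Set where
  K KB K4 K5 K45 KB5 KD KDB KD4 KD5 KD45 KT KTB S4 S5 : Logic

data AxD : Logic → Set where
  d-KD : AxD KD ; d-KDB : AxD KDB ; d-KD4 : AxD KD4 ; d-KD5 : AxD KD5 ; d-KD45 : AxD KD45

data AxT : Logic → Set where
  t-KT : AxT KT ; t-KTB : AxT KTB ; t-S4 : AxT S4 ; t-S5 : AxT S5

data AxB : Logic → Set where
  b-KB : AxB KB ; b-KB5 : AxB KB5 ; b-KDB : AxB KDB ; b-KTB : AxB KTB ; b-S5 : AxB S5

data Ax4 : Logic → Set where
  f-K4 : Ax4 K4 ; f-K45 : Ax4 K45 ; f-KB5 : Ax4 KB5 ; f-KD4 : Ax4 KD4
  f-KD45 : Ax4 KD45 ; f-S4 : Ax4 S4 ; f-S5 : Ax4 S5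

data Ax5 : Logic → Set where
  v-K5 : Ax5 K5 ; v-K45 : Ax5 K45 ; v-KB5 : Ax5 KB5 ; v-KD5 : Ax5 KD5
  v-KD45 : Ax5 KD45 ; v-S5 : Ax5 S5

data Thm (L : Logic) : Fm → Set where
  ax1 : ∀ α β → Thm L (α ⇒ (β ⇒ α))
  ax2 : ∀ α β γ → Thm L ((α ⇒ (β ⇒ γ)) ⇒ ((α ⇒ β) ⇒ (α ⇒ γ)))
  ax3 : ∀ α → Thm L (¬' (¬' α) ⇒ α)
  axk : ∀ α β → Thm L (□ (α ⇒ β) ⇒ (□ α ⇒ □ β))
  axD : AxD L → ∀ α → Thm L (□ α ⇒ ◇ α)
  axT : AxT L → ∀ α → Thm L (□ α ⇒ α)
  axB : AxB L → ∀ α → Thm L (α ⇒ □ (◇ α))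
  ax4 : Ax4 L → ∀ α → Thm L (□ α ⇒ □ (□ α))
  ax5 : Ax5 L → ∀ α → Thm L (◇ α ⇒ □ (◇ α))
  mp  : ∀ {α β} → Thm L (α ⇒ β) → Thm L α → Thm L β
  nec : ∀ {α} → Thm L α → Thm L (□ α)

_⊢[_]_ : Pred Fm 0ℓ → Logic → Fm → Set
Γ ⊢[ L ] α = Thm L α ⊎ Σ (List⁺ Fm) (λ gs → All⁺.All Γ gs × Thm L (⋀ gs ⇒ α))

data Val : Set where
  𝐅 𝐟 𝐟₂ 𝐟₃ 𝐭₃ 𝐭₂ 𝐭 𝐓 : Val

Des : Val → Set
Des x = x ∈ (𝐓 ∷ 𝐭 ∷ 𝐭₂ ∷ 𝐭₃ ∷ [])

VL : Logic → List Val
VL KB5 = 𝐅 ∷ 𝐟 ∷ 𝐟₂ ∷ 𝐭₂ ∷ 𝐭 ∷ 𝐓 ∷ []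
VL KD   = 𝐅 ∷ 𝐟 ∷ 𝐟₃ ∷ 𝐭₃ ∷ 𝐭 ∷ 𝐓 ∷ []
VL KDB  = 𝐅 ∷ 𝐟 ∷ 𝐟₃ ∷ 𝐭₃ ∷ 𝐭 ∷ 𝐓 ∷ []
VL KD4  = 𝐅 ∷ 𝐟 ∷ 𝐟₃ ∷ 𝐭₃ ∷ 𝐭 ∷ 𝐓 ∷ []
VL KD5  = 𝐅 ∷ 𝐟 ∷ 𝐟₃ ∷ 𝐭₃ ∷ 𝐭 ∷ 𝐓 ∷ []
VL KD45 = 𝐅 ∷ 𝐟 ∷ 𝐟₃ ∷ 𝐭₃ ∷ 𝐭 ∷ 𝐓 ∷ []
VL KT  = 𝐅 ∷ 𝐟 ∷ 𝐭 ∷ 𝐓 ∷ []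
VL KTB = 𝐅 ∷ 𝐟 ∷ 𝐭 ∷ 𝐓 ∷ []
VL S4  = 𝐅 ∷ 𝐟 ∷ 𝐭 ∷ 𝐓 ∷ []
VL S5  = 𝐅 ∷ 𝐟 ∷ 𝐭 ∷ 𝐓 ∷ []
VL _ = 𝐅 ∷ 𝐟 ∷ 𝐟₂ ∷ 𝐟₃ ∷ 𝐭₃ ∷ 𝐭₂ ∷ 𝐭 ∷ 𝐓 ∷ []

bot~ : List Val
bot~ = 𝐅 ∷ 𝐟₂ ∷ []

imp~ : Val → Val → List Val
imp~ 𝐅 _ = 𝐓 ∷ []
imp~ 𝐟 𝐅  = 𝐭 ∷ []
imp~ 𝐟 𝐟  = 𝐓 ∷ 𝐭 ∷ []
imp~ 𝐟 𝐟₂ = 𝐭₂ ∷ []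
imp~ 𝐟 𝐟₃ = 𝐓 ∷ []
imp~ 𝐟 𝐭₃ = 𝐭 ∷ []
imp~ 𝐟 𝐭₂ = 𝐓 ∷ []
imp~ 𝐟 𝐭  = 𝐓 ∷ 𝐭 ∷ []
imp~ 𝐟 𝐓  = 𝐓 ∷ []
imp~ 𝐟₂ 𝐅  = 𝐭₃ ∷ []
imp~ 𝐟₂ 𝐟  = 𝐭 ∷ []
imp~ 𝐟₂ 𝐟₂ = 𝐭₂ ∷ []
imp~ 𝐟₂ 𝐟₃ = 𝐓 ∷ []
imp~ 𝐟₂ 𝐭₃ = 𝐭₃ ∷ []
imp~ 𝐟₂ 𝐭₂ = 𝐭₂ ∷ []
imp~ 𝐟₂ 𝐭  = 𝐭 ∷ []
imp~ 𝐟₂ 𝐓  = 𝐓 ∷ []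
imp~ 𝐟₃ 𝐅  = 𝐭₃ ∷ []
imp~ 𝐟₃ 𝐟  = 𝐭 ∷ []
imp~ 𝐟₃ 𝐟₂ = 𝐭₂ ∷ []
imp~ 𝐟₃ 𝐟₃ = 𝐓 ∷ []
imp~ 𝐟₃ 𝐭₃ = 𝐭₃ ∷ []
imp~ 𝐟₃ 𝐭₂ = 𝐭₂ ∷ []
imp~ 𝐟₃ 𝐭  = 𝐭 ∷ []
imp~ 𝐟₃ 𝐓  = 𝐓 ∷ []
imp~ 𝐭₃ 𝐅  = 𝐟₃ ∷ []
imp~ 𝐭₃ 𝐟  = 𝐟₃ ∷ []
imp~ 𝐭₃ 𝐟₂ = 𝐟₃ ∷ []
imp~ 𝐭₃ 𝐟₃ = 𝐟₃ ∷ []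
imp~ 𝐭₃ _  = 𝐓 ∷ []
imp~ 𝐭₂ 𝐅  = 𝐅 ∷ []
imp~ 𝐭₂ 𝐟  = 𝐟 ∷ []
imp~ 𝐭₂ 𝐟₂ = 𝐟₂ ∷ []
imp~ 𝐭₂ 𝐟₃ = 𝐟₃ ∷ []
imp~ 𝐭₂ 𝐭₃ = 𝐭₃ ∷ []
imp~ 𝐭₂ 𝐭₂ = 𝐭₂ ∷ []
imp~ 𝐭₂ 𝐭  = 𝐭₃ ∷ []
imp~ 𝐭₂ 𝐓  = 𝐓 ∷ []
imp~ 𝐭 𝐅  = 𝐟 ∷ []
imp~ 𝐭 𝐟  = 𝐟 ∷ 𝐟₃ ∷ []
imp~ 𝐭 𝐟₂ = 𝐟₃ ∷ []
imp~ 𝐭 𝐟₃ = 𝐟₃ ∷ []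
imp~ 𝐭 𝐭₃ = 𝐭 ∷ []
imp~ 𝐭 𝐭₂ = 𝐓 ∷ []
imp~ 𝐭 𝐭  = 𝐓 ∷ 𝐭 ∷ []
imp~ 𝐭 𝐓  = 𝐓 ∷ []
imp~ 𝐓 y = y ∷ []

-- □̃ (arguments outside V(L) get the empty set; they never occur)
box~ : Logic → Val → List Val
box~ K 𝐟₂ = 𝐭₂ ∷ []
box~ K 𝐭₂ = 𝐭₂ ∷ []
box~ K 𝐟₃ = 𝐓 ∷ 𝐭 ∷ 𝐭₃ ∷ []
box~ K 𝐓  = 𝐓 ∷ 𝐭 ∷ 𝐭₃ ∷ []
box~ K _  = 𝐅 ∷ 𝐟 ∷ 𝐟₃ ∷ []
box~ KB 𝐅  = 𝐅 ∷ []
box~ KB 𝐟  = 𝐅 ∷ []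
box~ KB 𝐟₂ = 𝐭₂ ∷ []
box~ KB 𝐭₂ = 𝐭₂ ∷ []
box~ KB 𝐟₃ = 𝐭₃ ∷ []
box~ KB 𝐭₃ = 𝐅 ∷ 𝐟 ∷ 𝐟₃ ∷ []
box~ KB 𝐭  = 𝐅 ∷ 𝐟 ∷ 𝐟₃ ∷ []
box~ KB 𝐓  = 𝐓 ∷ 𝐭 ∷ 𝐭₃ ∷ []
box~ K4 𝐟₂ = 𝐭₂ ∷ []
box~ K4 𝐭₂ = 𝐭₂ ∷ []
box~ K4 𝐟₃ = 𝐓 ∷ []
box~ K4 𝐓  = 𝐓 ∷ []
box~ K4 _  = 𝐅 ∷ 𝐟 ∷ 𝐟₃ ∷ []
box~ K5 𝐟₂ = 𝐭₂ ∷ []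
box~ K5 𝐭₂ = 𝐭₂ ∷ []
box~ K5 𝐟₃ = 𝐓 ∷ 𝐭₃ ∷ []
box~ K5 𝐓  = 𝐓 ∷ 𝐭₃ ∷ []
box~ K5 _  = 𝐅 ∷ []
box~ K45 𝐟₂ = 𝐭₂ ∷ []
box~ K45 𝐭₂ = 𝐭₂ ∷ []
box~ K45 𝐟₃ = 𝐓 ∷ []
box~ K45 𝐓  = 𝐓 ∷ []
box~ K45 _  = 𝐅 ∷ []
box~ KB5 𝐅  = 𝐅 ∷ []
box~ KB5 𝐟  = 𝐅 ∷ []
box~ KB5 𝐭  = 𝐅 ∷ []
box~ KB5 𝐟₂ = 𝐭₂ ∷ []
box~ KB5 𝐭₂ = 𝐭₂ ∷ []
box~ KB5 𝐓  = 𝐓 ∷ []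
box~ KB5 _  = []
box~ KD 𝐅  = 𝐅 ∷ 𝐟 ∷ 𝐟₃ ∷ []
box~ KD 𝐟  = 𝐅 ∷ 𝐟 ∷ 𝐟₃ ∷ []
box~ KD 𝐭₃ = 𝐅 ∷ 𝐟 ∷ 𝐟₃ ∷ []
box~ KD 𝐭  = 𝐅 ∷ 𝐟 ∷ 𝐟₃ ∷ []
box~ KD 𝐟₃ = 𝐓 ∷ 𝐭 ∷ 𝐭₃ ∷ []
box~ KD 𝐓  = 𝐓 ∷ 𝐭 ∷ 𝐭₃ ∷ []
box~ KD _  = []
box~ KDB 𝐅  = 𝐅 ∷ []
box~ KDB 𝐟  = 𝐅 ∷ []
box~ KDB 𝐟₃ = 𝐭₃ ∷ []
box~ KDB 𝐭₃ = 𝐅 ∷ 𝐟 ∷ 𝐟₃ ∷ []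
box~ KDB 𝐭  = 𝐅 ∷ 𝐟 ∷ 𝐟₃ ∷ []
box~ KDB 𝐓  = 𝐓 ∷ 𝐭 ∷ 𝐭₃ ∷ []
box~ KDB _  = []
box~ KD4 𝐅  = 𝐅 ∷ []
box~ KD4 𝐭₃ = 𝐅 ∷ []
box~ KD4 𝐟  = 𝐅 ∷ 𝐟 ∷ 𝐟₃ ∷ []
box~ KD4 𝐭  = 𝐅 ∷ 𝐟 ∷ 𝐟₃ ∷ []
box~ KD4 𝐟₃ = 𝐓 ∷ []
box~ KD4 𝐓  = 𝐓 ∷ []
box~ KD4 _  = []
box~ KD5 𝐅  = 𝐅 ∷ []
box~ KD5 𝐟  = 𝐅 ∷ []
box~ KD5 𝐭₃ = 𝐅 ∷ []
box~ KD5 𝐭  = 𝐅 ∷ []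
box~ KD5 𝐟₃ = 𝐓 ∷ 𝐭₃ ∷ []
box~ KD5 𝐓  = 𝐓 ∷ 𝐭₃ ∷ []
box~ KD5 _  = []
box~ KD45 𝐅  = 𝐅 ∷ []
box~ KD45 𝐟  = 𝐅 ∷ []
box~ KD45 𝐭₃ = 𝐅 ∷ []
box~ KD45 𝐭  = 𝐅 ∷ []
box~ KD45 𝐟₃ = 𝐓 ∷ []
box~ KD45 𝐓  = 𝐓 ∷ []
box~ KD45 _  = []
box~ KT 𝐅 = 𝐅 ∷ []
box~ KT 𝐟 = 𝐅 ∷ 𝐟 ∷ []
box~ KT 𝐭 = 𝐅 ∷ 𝐟 ∷ []
box~ KT 𝐓 = 𝐓 ∷ 𝐭 ∷ []
box~ KT _ = []
box~ KTB 𝐅 = 𝐅 ∷ []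
box~ KTB 𝐟 = 𝐅 ∷ []
box~ KTB 𝐭 = 𝐅 ∷ 𝐟 ∷ []
box~ KTB 𝐓 = 𝐓 ∷ 𝐭 ∷ []
box~ KTB _ = []
box~ S4 𝐅 = 𝐅 ∷ []
box~ S4 𝐟 = 𝐅 ∷ 𝐟 ∷ []
box~ S4 𝐭 = 𝐅 ∷ 𝐟 ∷ []
box~ S4 𝐓 = 𝐓 ∷ []
box~ S4 _ = []
box~ S5 𝐅 = 𝐅 ∷ []
box~ S5 𝐟 = 𝐅 ∷ []
box~ S5 𝐭 = 𝐅 ∷ []
box~ S5 𝐓 = 𝐓 ∷ []
box~ S5 _ = []

record Valuation (L : Logic) : Set where
  field
    val     : Fm → Val
    val-V   : ∀ α → val α ∈ VL L
    val-⊥   : val ⊥' ∈ bot~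
    val-⇒   : ∀ α β → val (α ⇒ β) ∈ imp~ (val α) (val β)
    val-□   : ∀ α → val (□ α) ∈ box~ L (val α)
open Valuation public

Two : Val → Set
Two x = x ∈ (𝐟₂ ∷ 𝐭₂ ∷ [])

Level : (L : Logic) → ℕ → Valuation L → Set
Level L zero v = ∀ α → Two (val v α) → ∀ β → Two (val v β)
Level L (suc n) v =
  Level L n v ×
  (∀ α → (∀ (w : Valuation L) → Level L n w → Des (val w α))
       → val v α ∈ (𝐓 ∷ 𝐭₂ ∷ []))

InL : (L : Logic) → Valuation L → Set
InL L v = ∀ n → Level L n v

_⊨[_]_ : Pred Fm 0ℓ → Logic → Fm → Set
Γ ⊨[ L ] α = ∀ (v : Valuation L) → InL L v →
             (∀ β → Γ β → Des (val v β)) → Des (val v α)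

-- Canonical-model argument. Every maximal L-consistent set w yields a
-- valuation of 𝓜_L. If □⊥ ∈ w (a dead end, impossible in the presence of D
-- or T) a formula gets 𝐭₂ or 𝐟₂ according to membership in w. Otherwise it
-- gets the pair (φ ∈ w, status of φ), the status being necessary (□φ ∈ w),
-- impossible (□¬φ ∈ w) or contingent. On these six values →̃ is classical
-- implication paired with a three-valued table of statuses that (k) forces,
-- and □̃ admits every status of □φ compatible with the extra axioms of L;
-- these facts about the finite tables are decided by evaluation.
-- A formula designated by all level-n valuations is designated by all
-- canonical ones, so it lies in every maximal consistent set and is a
-- theorem, and then its canonical value is 𝐓 or 𝐭₂: canonical valuations
-- lie in L(𝓜_L). If Γ ⊬_L α, extending Γ ∪ {¬α} (Lindenbaum) gives one that
-- designates Γ but not α.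

module Submission where

open import Defs
open import Level using (0ℓ)
open import Relation.Unary using (Pred; _∪_; ｛_｝; _⊆_; ∅)
open import Axiom.ExcludedMiddle using (ExcludedMiddle)

open import Data.Bool using (Bool; true; false; T; not; _∨_)
open import Data.Empty using (⊥-elim)
open import Data.Fin as Fin using (Fin; #_)
open import Data.List using (List; []; _∷_; _++_; lookup)
open import Data.List.Membership.Propositional using (_∈_)
open import Data.List.Membership.Propositional.Properties using (∈-lookup)
open import Data.List.NonEmpty using (_∷_)
open import Data.List.NonEmpty.Relation.Unary.All as All⁺ using ()
open import Data.List.Relation.Unary.All as All using (All)
open import Data.List.Relation.Unary.All.Properties using (++⁺; ++⁻ˡ; ++⁻ʳ)
open import Data.List.Relation.Unary.Any as Any using (here; there)
open import Data.List.Relation.Unary.Any.Properties using (lookup-index)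
open import Data.Nat using (ℕ; zero; suc; _+_; _⊔_; _≤′_; ≤′-refl; ≤′-step)
open import Data.Nat.Properties using (+-identityʳ; +-suc; m≤m⊔n; m≤n⊔m; ≤⇒≤′)
open import Data.Product using (Σ; ∃; _×_; _,_; proj₁; proj₂)
open import Data.Sum using (_⊎_; inj₁; inj₂)
open import Function using (_∘_; id)
open import Relation.Binary.Definitions using (DecidableEquality)
open import Relation.Binary.PropositionalEquality using (_≡_; _≢_; refl; sym; trans; cong; cong₂; subst)
open import Relation.Nullary using (¬_; Dec; yes; no; does; proof)
open import Relation.Nullary.Decidable
  using (map′; from-yes; decidable-stable; T?; ¬?; _×-dec_; _⊎-dec_; _→-dec_; dec-true; dec-false)
open import Relation.Nullary.Reflects using (Reflects; ofʸ; ofⁿ; det; _→-reflects_)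

record Finite (A : Set) : Set where
  field
    elements : List A
    complete : ∀ x → x ∈ elements

open Finite ⦃ … ⦄

module _ {A : Set} ⦃ _ : Finite A ⦄ where

  infix 4 _≟_ _∈?_

  ∀? : {P : A → Set} → (∀ x → Dec (P x)) → Dec (∀ x → P x)
  ∀? P? = map′ (λ ps x → All.lookup ps (complete x)) (λ f → All.tabulate λ {x} _ → f x)
               (All.all? P? elements)

  _≟_ : DecidableEquality A
  x ≟ y = map′ position-injective (cong position) (position x Fin.≟ position y)
    where
    position : A → Fin _
    position z = Any.index (complete z)
    position-injective : position x ≡ position y → x ≡ y
    position-injective e =
      trans (lookup-index (complete x)) (trans (cong (lookup elements) e) (sym (lookup-index (complete y))))

  _∈?_ : ∀ x xs → Dec (x ∈ xs)
  x ∈? xs = Any.any? (x ≟_) xs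

data Status : Set where
  necessary impossible contingent : Status

instance
  finite-Bool : Finite Bool
  finite-Bool = record { elements = true ∷ false ∷ [] ; complete = listed }
    where
    listed : ∀ b → b ∈ true ∷ false ∷ []
    listed true  = ∈-lookup (# 0)
    listed false = ∈-lookup (# 1)

  finite-Status : Finite Status
  finite-Status = record { elements = necessary ∷ impossible ∷ contingent ∷ [] ; complete = listed }
    where
    listed : ∀ s → s ∈ necessary ∷ impossible ∷ contingent ∷ []
    listed necessary  = ∈-lookup (# 0)
    listed impossible = ∈-lookup (# 1)
    listed contingent = ∈-lookup (# 2)

  finite-Val : Finite Val
  finite-Val = record { elements = values ; complete = listed }
    where
    values : List Val
    values = 𝐅 ∷ 𝐟 ∷ 𝐟₂ ∷ 𝐟₃ ∷ 𝐭₃ ∷ 𝐭₂ ∷ 𝐭 ∷ 𝐓 ∷ []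
    listed : ∀ x → x ∈ values
    listed 𝐅  = ∈-lookup (# 0)
    listed 𝐟  = ∈-lookup (# 1)
    listed 𝐟₂ = ∈-lookup (# 2)
    listed 𝐟₃ = ∈-lookup (# 3)
    listed 𝐭₃ = ∈-lookup (# 4)
    listed 𝐭₂ = ∈-lookup (# 5)
    listed 𝐭  = ∈-lookup (# 6)
    listed 𝐓  = ∈-lookup (# 7)

  finite-Logic : Finite Logic
  finite-Logic = record { elements = logics ; complete = listed }
    where
    logics : List Logic
    logics = K ∷ KB ∷ K4 ∷ K5 ∷ K45 ∷ KB5 ∷ KD ∷ KDB ∷ KD4 ∷ KD5 ∷ KD45 ∷ KT ∷ KTB ∷ S4 ∷ S5 ∷ []
    listed : ∀ L → L ∈ logics
    listed K    = ∈-lookup (# 0)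
    listed KB   = ∈-lookup (# 1)
    listed K4   = ∈-lookup (# 2)
    listed K5   = ∈-lookup (# 3)
    listed K45  = ∈-lookup (# 4)
    listed KB5  = ∈-lookup (# 5)
    listed KD   = ∈-lookup (# 6)
    listed KDB  = ∈-lookup (# 7)
    listed KD4  = ∈-lookup (# 8)
    listed KD5  = ∈-lookup (# 9)
    listed KD45 = ∈-lookup (# 10)
    listed KT   = ∈-lookup (# 11)
    listed KTB  = ∈-lookup (# 12)
    listed S4   = ∈-lookup (# 13)
    listed S5   = ∈-lookup (# 14)

-- The tables of 𝓜_L on canonical values

record Axioms (L : Logic) : Set where
  constructor axioms
  field
    d? : Dec (AxD L)
    t? : Dec (AxT L)
    b? : Dec (AxB L)
    4? : Dec (Ax4 L)
    5? : Dec (Ax5 L)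

axioms-of : ∀ L → Axioms L
axioms-of K    = axioms (no λ ())     (no λ ())    (no λ ())    (no λ ())     (no λ ())
axioms-of KB   = axioms (no λ ())     (no λ ())    (yes b-KB)   (no λ ())     (no λ ())
axioms-of K4   = axioms (no λ ())     (no λ ())    (no λ ())    (yes f-K4)    (no λ ())
axioms-of K5   = axioms (no λ ())     (no λ ())    (no λ ())    (no λ ())     (yes v-K5)
axioms-of K45  = axioms (no λ ())     (no λ ())    (no λ ())    (yes f-K45)   (yes v-K45)
axioms-of KB5  = axioms (no λ ())     (no λ ())    (yes b-KB5)  (yes f-KB5)   (yes v-KB5)
axioms-of KD   = axioms (yes d-KD)    (no λ ())    (no λ ())    (no λ ())     (no λ ())
axioms-of KDB  = axioms (yes d-KDB)   (no λ ())    (yes b-KDB)  (no λ ())     (no λ ())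
axioms-of KD4  = axioms (yes d-KD4)   (no λ ())    (no λ ())    (yes f-KD4)   (no λ ())
axioms-of KD5  = axioms (yes d-KD5)   (no λ ())    (no λ ())    (no λ ())     (yes v-KD5)
axioms-of KD45 = axioms (yes d-KD45)  (no λ ())    (no λ ())    (yes f-KD45)  (yes v-KD45)
axioms-of KT   = axioms (no λ ())     (yes t-KT)   (no λ ())    (no λ ())     (no λ ())
axioms-of KTB  = axioms (no λ ())     (yes t-KTB)  (yes b-KTB)  (no λ ())     (no λ ())
axioms-of S4   = axioms (no λ ())     (yes t-S4)   (no λ ())    (yes f-S4)    (no λ ())
axioms-of S5   = axioms (no λ ())     (yes t-S5)   (yes b-S5)   (yes f-S5)    (yes v-S5)

module _ (L : Logic) where
  open Axioms (axioms-of L) public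

⟨_,_⟩ : Bool → Status → Val
⟨ true  , necessary  ⟩ = 𝐓
⟨ true  , impossible ⟩ = 𝐭₃
⟨ true  , contingent ⟩ = 𝐭
⟨ false , necessary  ⟩ = 𝐟₃
⟨ false , impossible ⟩ = 𝐅
⟨ false , contingent ⟩ = 𝐟

dead-end : Bool → Val
dead-end true  = 𝐭₂
dead-end false = 𝐟₂

isNecessary : Status → Bool
isNecessary necessary = true
isNecessary _         = false

reflects-⇔ : ∀ {A B : Set} {b} → (A → B) → (B → A) → Reflects A b → Reflects B b
reflects-⇔ f g (ofʸ a)  = ofʸ (f a)
reflects-⇔ f g (ofⁿ ¬a) = ofⁿ (¬a ∘ g)

isNecessary-reflects : ∀ s → Reflects (s ≡ necessary) (isNecessary s)
isNecessary-reflects necessary  = ofʸ refl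
isNecessary-reflects impossible = ofⁿ λ ()
isNecessary-reflects contingent = ofⁿ λ ()

_⇒ˢ_ : Status → Status → List Status
impossible ⇒ˢ _          = necessary ∷ []
necessary  ⇒ˢ necessary  = necessary ∷ []
contingent ⇒ˢ necessary  = necessary ∷ []
necessary  ⇒ˢ impossible = impossible ∷ []
necessary  ⇒ˢ contingent = contingent ∷ []
contingent ⇒ˢ impossible = contingent ∷ []
contingent ⇒ˢ contingent = necessary ∷ contingent ∷ []

Admissible : Bool → Status → Set
Admissible i s = (s ≡ necessary → T i) × (s ≡ impossible → ¬ T i)

Reflexive : Logic → Set
Reflexive L = AxT L ⊎ AxB L × Ax4 L

-- Constraints on the status u of □φ, given the truth value i and the status s of φ.
BoxLaws : Logic → Bool → Status → Status → Set
BoxLaws L i s u =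
    (Ax4 L → s ≡ necessary → u ≡ necessary)
  × (Ax5 L → s ≢ necessary → u ≡ impossible)
  × (Ax5 L → u ≢ contingent)
  × (AxB L → ¬ T i → u ≡ impossible)
  × (AxT L ⊎ AxD L × Ax4 L → s ≡ impossible → u ≡ impossible)
  × (Reflexive L → Admissible i s × Admissible (isNecessary s) u)

admissible? : ∀ i s → Dec (Admissible i s)
admissible? i s = (s ≟ necessary →-dec T? i) ×-dec (s ≟ impossible →-dec ¬? (T? i))

reflexive? : ∀ L → Dec (Reflexive L)
reflexive? L = t? L ⊎-dec b? L ×-dec 4? L

boxLaws? : ∀ L i s u → Dec (BoxLaws L i s u)
boxLaws? L i s u =
        (4? L →-dec (s ≟ necessary →-dec u ≟ necessary))
  ×-dec (5? L →-dec (¬? (s ≟ necessary) →-dec u ≟ impossible))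
  ×-dec (5? L →-dec ¬? (u ≟ contingent))
  ×-dec (b? L →-dec (¬? (T? i) →-dec u ≟ impossible))
  ×-dec ((t? L ⊎-dec d? L ×-dec 4? L) →-dec (s ≟ impossible →-dec u ≟ impossible))
  ×-dec (reflexive? L →-dec admissible? i s ×-dec admissible? (isNecessary s) u)

Des? : ∀ x → Dec (Des x)
Des? x = x ∈? 𝐓 ∷ 𝐭 ∷ 𝐭₂ ∷ 𝐭₃ ∷ []

Two? : ∀ x → Dec (Two x)
Two? x = x ∈? 𝐟₂ ∷ 𝐭₂ ∷ []

imp~-live : ∀ i j s t u → u ∈ s ⇒ˢ t → ⟨ not i ∨ j , u ⟩ ∈ imp~ ⟨ i , s ⟩ ⟨ j , t ⟩
imp~-live = from-yes (∀? λ i → ∀? λ j → ∀? λ s → ∀? λ t → ∀? λ u →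
  u ∈? s ⇒ˢ t →-dec ⟨ not i ∨ j , u ⟩ ∈? imp~ ⟨ i , s ⟩ ⟨ j , t ⟩)

box~-live : ∀ L i s u → BoxLaws L i s u → ⟨ isNecessary s , u ⟩ ∈ box~ L ⟨ i , s ⟩
box~-live = from-yes (∀? λ L → ∀? λ i → ∀? λ s → ∀? λ u →
  boxLaws? L i s u →-dec ⟨ isNecessary s , u ⟩ ∈? box~ L ⟨ i , s ⟩)

VL-live : ∀ L i s → (Reflexive L → Admissible i s) → ⟨ i , s ⟩ ∈ VL L
VL-live = from-yes (∀? λ L → ∀? λ i → ∀? λ s →
  (reflexive? L →-dec admissible? i s) →-dec ⟨ i , s ⟩ ∈? VL L)

Des-live : ∀ i s → (Des ⟨ i , s ⟩ → T i) × (T i → Des ⟨ i , s ⟩)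
Des-live = from-yes (∀? λ i → ∀? λ s →
  (Des? ⟨ i , s ⟩ →-dec T? i) ×-dec (T? i →-dec Des? ⟨ i , s ⟩))

live-not-Two : ∀ i s → ¬ Two ⟨ i , s ⟩
live-not-Two = from-yes (∀? λ i → ∀? λ s → ¬? (Two? ⟨ i , s ⟩))

imp~-dead-end : ∀ i j → dead-end (not i ∨ j) ∈ imp~ (dead-end i) (dead-end j)
imp~-dead-end = from-yes (∀? λ i → ∀? λ j → dead-end (not i ∨ j) ∈? imp~ (dead-end i) (dead-end j))

box~-dead-end : ∀ L i → ¬ AxD L × ¬ AxT L → dead-end true ∈ box~ L (dead-end i)
box~-dead-end = from-yes (∀? λ L → ∀? λ i →
  (¬? (d? L) ×-dec ¬? (t? L)) →-dec dead-end true ∈? box~ L (dead-end i))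

VL-dead-end : ∀ L i → ¬ AxD L × ¬ AxT L → dead-end i ∈ VL L
VL-dead-end = from-yes (∀? λ L → ∀? λ i →
  (¬? (d? L) ×-dec ¬? (t? L)) →-dec dead-end i ∈? VL L)

Des-dead-end : ∀ i → (Des (dead-end i) → T i) × (T i → Des (dead-end i))
Des-dead-end = from-yes (∀? λ i →
  (Des? (dead-end i) →-dec T? i) ×-dec (T? i →-dec Des? (dead-end i)))

dead-end-Two : ∀ i → Two (dead-end i)
dead-end-Two = from-yes (∀? λ i → Two? (dead-end i))

-- Enumerating formulas

next : ℕ × ℕ → ℕ × ℕ
next (zero  , b) = suc b , zero
next (suc a , b) = a , suc b

unpair : ℕ → ℕ × ℕ
unpair zero    = zero , zero
unpair (suc n) = next (unpair n)

Reached : ℕ × ℕ → Set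
Reached p = ∃ λ n → unpair n ≡ p

reached-next : ∀ {p} → Reached p → Reached (next p)
reached-next (n , e) = suc n , cong next e

reached-along-diagonal : ∀ b a → Reached (a + b , zero) → Reached (a , b)
reached-along-diagonal zero    a r = subst (λ x → Reached (x , zero)) (+-identityʳ a) r
reached-along-diagonal (suc b) a r =
  reached-next (reached-along-diagonal b (suc a) (subst (λ x → Reached (x , zero)) (+-suc a b) r))

reached-diagonal : ∀ d → Reached (d , zero)
reached-diagonal zero    = zero , refl
reached-diagonal (suc d) = reached-next (reached-along-diagonal d zero (reached-diagonal d))

unpair-surjective : ∀ p → Reached p
unpair-surjective (a , b) = reached-along-diagonal b a (reached-diagonal (a + b))

pair : ℕ × ℕ → ℕ
pair p = proj₁ (unpair-surjective p)

pair-injective : ∀ {p q} → pair p ≡ pair q → p ≡ q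
pair-injective {p} {q} e =
  trans (sym (proj₂ (unpair-surjective p))) (trans (cong unpair e) (proj₂ (unpair-surjective q)))

code : Fm → ℕ
shape : Fm → ℕ × ℕ
code φ = pair (shape φ)
shape (var n) = 0 , n
shape ⊥'      = 1 , 0
shape (φ ⇒ ψ) = 2 , pair (code φ , code ψ)
shape (□ φ)   = 3 , code φ

code-injective : ∀ φ ψ → code φ ≡ code ψ → φ ≡ ψ
shape-injective : ∀ φ ψ → shape φ ≡ shape ψ → φ ≡ ψ
code-injective φ ψ e = shape-injective φ ψ (pair-injective e)
shape-injective (var n) (var .n) refl = refl
shape-injective ⊥' ⊥' _ = refl
shape-injective (φ ⇒ ψ) (φ′ ⇒ ψ′) e =
  cong₂ _⇒_ (code-injective φ φ′ (cong proj₁ codes)) (code-injective ψ ψ′ (cong proj₂ codes))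
  where codes = pair-injective (cong proj₂ e)
shape-injective (□ φ) (□ φ′) e = cong □ (code-injective φ φ′ (cong proj₂ e))

module _ (em : ExcludedMiddle 0ℓ) where

  decode : ∀ {n} → Dec (∃ λ φ → code φ ≡ n) → Fm
  decode (yes (φ , _)) = φ
  decode (no _)        = ⊥'

  enumerate : ℕ → Fm
  enumerate n = decode (em {∃ λ φ → code φ ≡ n})

  enumerate-code : ∀ φ → enumerate (code φ) ≡ φ
  enumerate-code φ = decode-code em
    where
    decode-code : (d : Dec (∃ λ ψ → code ψ ≡ code φ)) → decode d ≡ φ
    decode-code (yes (ψ , e)) = code-injective ψ φ e
    decode-code (no ∄)        = ⊥-elim (∄ (φ , refl))

module Derivability (L : Logic) where

  infix 3 ⊢_ _⊢ₕ_

  ⊢_ : Fm → Set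
  ⊢ φ = Thm L φ

  ⇒-refl : ∀ φ → ⊢ φ ⇒ φ
  ⇒-refl φ = mp (mp (ax2 φ (φ ⇒ φ) φ) (ax1 φ (φ ⇒ φ))) (ax1 φ φ)

  □-mono : ∀ {φ ψ} → ⊢ φ ⇒ ψ → ⊢ □ φ ⇒ □ ψ
  □-mono {φ} {ψ} t = mp (axk φ ψ) (nec t)

  data _⊢ₕ_ (Δ : Pred Fm 0ℓ) : Fm → Set where
    hyp : ∀ {φ} → Δ φ → Δ ⊢ₕ φ
    thm : ∀ {φ} → ⊢ φ → Δ ⊢ₕ φ
    mp  : ∀ {φ ψ} → Δ ⊢ₕ φ ⇒ ψ → Δ ⊢ₕ φ → Δ ⊢ₕ ψ

  Consistent : Pred Fm 0ℓ → Set
  Consistent Δ = ¬ (Δ ⊢ₕ ⊥')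

  weaken : ∀ {Δ Δ′ φ} → Δ ⊆ Δ′ → Δ ⊢ₕ φ → Δ′ ⊢ₕ φ
  weaken Δ⊆Δ′ (hyp p)  = hyp (Δ⊆Δ′ p)
  weaken Δ⊆Δ′ (thm t)  = thm t
  weaken Δ⊆Δ′ (mp d e) = mp (weaken Δ⊆Δ′ d) (weaken Δ⊆Δ′ e)

  deduction : ∀ {Δ χ φ} → Δ ∪ ｛ χ ｝ ⊢ₕ φ → Δ ⊢ₕ χ ⇒ φ
  deduction {φ = φ} (hyp (inj₁ p)) = mp (thm (ax1 φ _)) (hyp p)
  deduction (hyp (inj₂ refl))      = thm (⇒-refl _)
  deduction {φ = φ} (thm t)        = mp (thm (ax1 φ _)) (thm t)
  deduction (mp d e)               = mp (mp (thm (ax2 _ _ _)) (deduction d)) (deduction e)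

  by-contradiction : ∀ {Δ φ} → Δ ∪ ｛ ¬' φ ｝ ⊢ₕ ⊥' → Δ ⊢ₕ φ
  by-contradiction {φ = φ} d = mp (thm (ax3 φ)) (deduction d)

  ⊢ₕ-∅ : ∀ {φ} → ∅ ⊢ₕ φ → ⊢ φ
  ⊢ₕ-∅ (thm t)  = t
  ⊢ₕ-∅ (mp d e) = mp (⊢ₕ-∅ d) (⊢ₕ-∅ e)

  ex-falso : ∀ φ ψ → ⊢ ¬' φ ⇒ φ ⇒ ψ
  ex-falso φ ψ = ⊢ₕ-∅ (deduction (deduction (by-contradiction (weaken inj₁ contradiction))))
    where
    contradiction : (∅ ∪ ｛ ¬' φ ｝) ∪ ｛ φ ｝ ⊢ₕ ⊥'
    contradiction = mp (hyp (inj₁ (inj₂ refl))) (hyp (inj₂ refl))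

  settle : ∀ {P : Set} → Dec P → Fm → Fm
  settle (yes _) φ = ¬' φ
  settle (no _)  φ = φ

  settle-consistent : ∀ {Δ φ} → Consistent Δ → (d : Dec (Δ ⊢ₕ ¬' φ)) → Consistent (Δ ∪ ｛ settle d φ ｝)
  settle-consistent con (yes ⊢¬φ) d = con (mp (deduction d) ⊢¬φ)
  settle-consistent con (no ⊬¬φ)  d = ⊬¬φ (deduction d)

  settle-decides : ∀ {P : Set} (d : Dec P) φ → settle d φ ≡ φ ⊎ settle d φ ≡ ¬' φ
  settle-decides (yes _) φ = inj₂ refl
  settle-decides (no _)  φ = inj₁ refl

-- Maximal consistent sets and canonical valuations

module CanonicalModel (L : Logic) (em : ExcludedMiddle 0ℓ) where
  open Derivability L

  record MCS : Set₁ where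
    field
      member  : Pred Fm 0ℓ
      ∋-mp    : ∀ {φ ψ} → member (φ ⇒ ψ) → member φ → member ψ
      ∋-thm   : ∀ {φ} → ⊢ φ → member φ
      ∌-⊥     : ¬ member ⊥'
      ∋-total : ∀ φ → member φ ⊎ member (¬' φ)

  open MCS public

  infix 4 _∋_ _∌_

  _∋_ : MCS → Fm → Set
  w ∋ φ = member w φ

  _∌_ : MCS → Fm → Set
  w ∌ φ = ¬ (w ∋ φ)

  module Lindenbaum (Δ₀ : Pred Fm 0ℓ) (Δ₀-consistent : Consistent Δ₀) where

    stage : ℕ → Pred Fm 0ℓ
    decision : ∀ n → Dec (stage n ⊢ₕ ¬' (enumerate em n))
    stage zero    = Δ₀
    stage (suc n) = stage n ∪ ｛ settle (decision n) (enumerate em n) ｝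
    decision n = em

    stage-consistent : ∀ n → Consistent (stage n)
    stage-consistent zero    = Δ₀-consistent
    stage-consistent (suc n) = settle-consistent (stage-consistent n) (decision n)

    stage-mono : ∀ {m n} → m ≤′ n → stage m ⊆ stage n
    stage-mono ≤′-refl         = id
    stage-mono (≤′-step m≤′n) = inj₁ ∘ stage-mono m≤′n

    Member : Pred Fm 0ℓ
    Member φ = ∃ λ n → stage n ⊢ₕ φ

    member-mp : ∀ {φ ψ} → Member (φ ⇒ ψ) → Member φ → Member ψ
    member-mp (m , d) (n , e) =
      m ⊔ n , mp (weaken (stage-mono (≤⇒≤′ (m≤m⊔n m n))) d) (weaken (stage-mono (≤⇒≤′ (m≤n⊔m m n))) e)

    member-total : ∀ φ → Member φ ⊎ Member (¬' φ)
    member-total φ with settle-decides (decision (code φ)) (enumerate em (code φ))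
    ... | inj₁ e = inj₁ (suc (code φ) , hyp (inj₂ (trans e (enumerate-code em φ))))
    ... | inj₂ e = inj₂ (suc (code φ) , hyp (inj₂ (trans e (cong ¬' (enumerate-code em φ)))))

    mcs : MCS
    mcs = record
      { member  = Member
      ; ∋-mp    = member-mp
      ; ∋-thm   = λ t → zero , thm t
      ; ∌-⊥     = λ (n , d) → stage-consistent n d
      ; ∋-total = member-total
      }

  lindenbaum : ∀ Δ → Consistent Δ → Σ MCS λ w → Δ ⊆ member w
  lindenbaum Δ con = Lindenbaum.mcs Δ con , λ p → zero , hyp p

  module _ (w : MCS) where

    ∋-by-contradiction : ∀ {φ} → ¬ (w ∌ φ) → w ∋ φ
    ∋-by-contradiction {φ} ¬∌φ with ∋-total w φ
    ... | inj₁ φ∈  = φ∈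
    ... | inj₂ ¬φ∈ = ⊥-elim (¬∌φ (∌-⊥ w ∘ ∋-mp w ¬φ∈))

    ∋-¬⁺ : ∀ {φ} → w ∌ φ → w ∋ ¬' φ
    ∋-¬⁺ {φ} ∌φ with ∋-total w φ
    ... | inj₁ φ∈  = ⊥-elim (∌φ φ∈)
    ... | inj₂ ¬φ∈ = ¬φ∈

    ∋-¬⁻ : ∀ {φ} → w ∋ ¬' φ → w ∌ φ
    ∋-¬⁻ ¬φ∈ = ∌-⊥ w ∘ ∋-mp w ¬φ∈

    ∋-⇒⁺ : ∀ {φ ψ} → (w ∋ φ → w ∋ ψ) → w ∋ φ ⇒ ψ
    ∋-⇒⁺ {φ} {ψ} f with em {w ∋ φ}
    ... | yes φ∈ = ∋-mp w (∋-thm w (ax1 ψ φ)) (f φ∈)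
    ... | no ∌φ  = ∋-mp w (∋-thm w (ex-falso φ ψ)) (∋-¬⁺ ∌φ)

    ∋-⇒-by-consequent : ∀ {φ ψ} → w ∋ ψ → w ∋ φ ⇒ ψ
    ∋-⇒-by-consequent ψ∈ = ∋-⇒⁺ (λ _ → ψ∈)

    ∋-⇒-by-¬antecedent : ∀ {φ ψ} → w ∋ ¬' φ → w ∋ φ ⇒ ψ
    ∋-⇒-by-¬antecedent ¬φ∈ = ∋-⇒⁺ (⊥-elim ∘ ∋-¬⁻ ¬φ∈)

    ∋-modus-tollens : ∀ {φ ψ} → w ∋ φ ⇒ ψ → w ∋ ¬' ψ → w ∋ ¬' φ
    ∋-modus-tollens φ⇒ψ∈ ¬ψ∈ = ∋-¬⁺ (∋-¬⁻ ¬ψ∈ ∘ ∋-mp w φ⇒ψ∈)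

    ∋-¬⇒⁺ : ∀ {φ ψ} → w ∋ φ → w ∋ ¬' ψ → w ∋ ¬' (φ ⇒ ψ)
    ∋-¬⇒⁺ φ∈ ¬ψ∈ = ∋-¬⁺ (λ φ⇒ψ∈ → ∋-¬⁻ ¬ψ∈ (∋-mp w φ⇒ψ∈ φ∈))

    ∋-¬⇒⁻ˡ : ∀ {φ ψ} → w ∋ ¬' (φ ⇒ ψ) → w ∋ φ
    ∋-¬⇒⁻ˡ ¬φ⇒ψ∈ = ∋-by-contradiction (∋-¬⁻ ¬φ⇒ψ∈ ∘ ∋-⇒-by-¬antecedent ∘ ∋-¬⁺)

    ∋-¬⇒⁻ʳ : ∀ {φ ψ} → w ∋ ¬' (φ ⇒ ψ) → w ∋ ¬' ψ
    ∋-¬⇒⁻ʳ ¬φ⇒ψ∈ = ∋-¬⁺ (∋-¬⁻ ¬φ⇒ψ∈ ∘ ∋-⇒-by-consequent)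

    ∋-∧⁻ : ∀ {φ ψ} → w ∋ φ ∧' ψ → w ∋ φ × w ∋ ψ
    ∋-∧⁻ φ∧ψ∈ = ∋-¬⇒⁻ˡ φ∧ψ∈ , ∋-by-contradiction (∋-¬⁻ (∋-¬⇒⁻ʳ φ∧ψ∈) ∘ ∋-¬⁺)

    ∋-⋀⁻ : ∀ γ γs → w ∋ ⋀ (γ ∷ γs) → All (w ∋_) (γ ∷ γs)
    ∋-⋀⁻ γ []       γ∈ = γ∈ All.∷ All.[]
    ∋-⋀⁻ γ (δ ∷ δs) ⋀∈ = proj₁ (∋-∧⁻ ⋀∈) All.∷ ∋-⋀⁻ δ δs (proj₂ (∋-∧⁻ ⋀∈))

  ⊢-by-MCS : ∀ {φ} → (∀ w → w ∋ φ) → ⊢ φ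
  ⊢-by-MCS {φ} ∋φ = decidable-stable em λ ⊬φ →
    let w , ¬φ∈w = lindenbaum (∅ ∪ ｛ ¬' φ ｝) (⊬φ ∘ ⊢ₕ-∅ ∘ by-contradiction)
    in ∋-¬⁻ w (¬φ∈w (inj₂ refl)) (∋φ w)

  ⊢⇒-by-MCS : ∀ {φ ψ} → (∀ w → w ∋ φ → w ∋ ψ) → ⊢ φ ⇒ ψ
  ⊢⇒-by-MCS f = ⊢-by-MCS λ w → ∋-⇒⁺ w (f w)

  □-lift₁ : ∀ {φ ψ} → (∀ u → u ∋ φ → u ∋ ψ) → ∀ w → w ∋ □ φ → w ∋ □ ψ
  □-lift₁ f w = ∋-mp w (∋-thm w (□-mono (⊢⇒-by-MCS f)))

  □-lift₂ : ∀ {φ ψ χ} → (∀ u → u ∋ φ → u ∋ ψ → u ∋ χ) → ∀ w → w ∋ □ φ → w ∋ □ ψ → w ∋ □ χ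
  □-lift₂ {φ} {ψ} {χ} f w □φ∈ = ∋-mp w (∋-mp w (∋-thm w (axk ψ χ)) (□-lift₁ (λ u → ∋-⇒⁺ u ∘ f u) w □φ∈))

  finite-premises : ∀ {Γ φ} → Γ ⊢ₕ φ → ∃ λ γs → All Γ γs × (∀ w → All (w ∋_) γs → w ∋ φ)
  finite-premises (hyp γ∈Γ) = _ ∷ [] , γ∈Γ All.∷ All.[] , λ { w (γ∈ All.∷ All.[]) → γ∈ }
  finite-premises (thm t)   = [] , All.[] , λ w _ → ∋-thm w t
  finite-premises (mp d e) with finite-premises d | finite-premises e
  ... | γs , γs⊆Γ , f | δs , δs⊆Γ , g =
    γs ++ δs , ++⁺ γs⊆Γ δs⊆Γ , λ w ∈w → ∋-mp w (f w (++⁻ˡ γs ∈w)) (g w (++⁻ʳ γs ∈w))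

  ⊢ₕ-finitary : ∀ {Γ φ} → Γ ⊢ₕ φ → Γ ⊢[ L ] φ
  ⊢ₕ-finitary d with finite-premises d
  ... | []     , _              , f = inj₁ (⊢-by-MCS λ w → f w All.[])
  ... | γ ∷ γs , γ∈Γ All.∷ γs⊆Γ , f = inj₂ (γ ∷ γs , γ∈Γ All⁺.∷ γs⊆Γ , ⊢⇒-by-MCS λ w → f w ∘ ∋-⋀⁻ w γ γs)

  module _ (w : MCS) where

    □-⊥ : ∀ {φ} → w ∋ □ φ → w ∋ □ (¬' φ) → w ∋ □ ⊥'
    □-⊥ = □-lift₂ (λ u φ∈ ¬φ∈ → ∋-mp u ¬φ∈ φ∈) w

    ∋-◇¬⁺ : ∀ {φ} → w ∌ □ φ → w ∋ ◇ (¬' φ)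
    ∋-◇¬⁺ ∌□φ = ∋-¬⁺ w (∌□φ ∘ □-lift₁ (λ u ¬¬φ∈ → ∋-by-contradiction u (∋-¬⁻ u ¬¬φ∈ ∘ ∋-¬⁺ u)) w)

    ∋-◇¬⁻ : ∀ {φ} → w ∋ ◇ (¬' φ) → w ∌ □ φ
    ∋-◇¬⁻ ◇¬φ∈ = ∋-¬⁻ w ◇¬φ∈ ∘ □-lift₁ (λ u φ∈ → ∋-¬⁺ u (λ ¬φ∈ → ∋-¬⁻ u ¬φ∈ φ∈)) w

    ∋-D : ∀ {φ} → AxD L → w ∋ □ φ → w ∌ □ (¬' φ)
    ∋-D {φ} ax □φ∈ = ∋-¬⁻ w (∋-mp w (∋-thm w (axD ax φ)) □φ∈)

    ∋-T : ∀ {φ} → AxT L → w ∋ □ φ → w ∋ φ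
    ∋-T {φ} ax = ∋-mp w (∋-thm w (axT ax φ))

    ∋-4 : ∀ {φ} → Ax4 L → w ∋ □ φ → w ∋ □ (□ φ)
    ∋-4 {φ} ax = ∋-mp w (∋-thm w (ax4 ax φ))

  module _ (w : MCS) where

    ∋-B : ∀ {φ} → AxB L → w ∌ φ → w ∋ □ (¬' (□ φ))
    ∋-B {φ} ax ∌φ = □-lift₁ (λ u → ∋-¬⁺ u ∘ ∋-◇¬⁻ u) w (∋-mp w (∋-thm w (axB ax (¬' φ))) (∋-¬⁺ w ∌φ))

    ∋-5 : ∀ {φ} → Ax5 L → w ∌ □ φ → w ∋ □ (¬' (□ φ))
    ∋-5 {φ} ax ∌□φ = □-lift₁ (λ u → ∋-¬⁺ u ∘ ∋-◇¬⁻ u) w (∋-mp w (∋-thm w (ax5 ax (¬' φ))) (∋-◇¬⁺ w ∌□φ))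

  ∋-5′ : ∀ {φ} → Ax5 L → ∀ w → w ∌ □ (¬' (□ φ)) → w ∋ □ (□ φ)
  ∋-5′ {φ} ax w ∌□¬□φ = □-lift₁ ◇□φ→□φ w (∋-mp w (∋-thm w (ax5 ax (□ φ))) (∋-¬⁺ w ∌□¬□φ))
    where
    ◇□φ→□φ : ∀ u → u ∋ ◇ (□ φ) → u ∋ □ φ
    ◇□φ→□φ u ◇□φ∈ = ∋-by-contradiction u (∋-¬⁻ u ◇□φ∈ ∘ ∋-5 u ax)

  ∋-□¬□ : ∀ {φ} → AxT L ⊎ AxD L × Ax4 L → ∀ w → w ∋ □ (¬' φ) → w ∋ □ (¬' (□ φ))
  ∋-□¬□ (inj₁ t)       = □-lift₁ (λ u ¬φ∈ → ∋-¬⁺ u (∋-¬⁻ u ¬φ∈ ∘ ∋-T u t))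
  ∋-□¬□ (inj₂ (d , f)) w = □-lift₁ (λ u □¬φ∈ → ∋-¬⁺ u (λ □φ∈ → ∋-D u d □φ∈ □¬φ∈)) w ∘ ∋-4 w f

  -- With B and 4, □φ together with ¬φ gives both □□φ and □¬□φ, hence □⊥.
  ∋-reflexive : ∀ {φ} → Reflexive L → ∀ w → w ∌ □ ⊥' → w ∋ □ φ → w ∋ φ
  ∋-reflexive (inj₁ t)       w _    = ∋-T w t
  ∋-reflexive (inj₂ (b , f)) w live □φ∈ =
    ∋-by-contradiction w λ ∌φ → live (□-⊥ w (∋-4 w f □φ∈) (∋-B w b ∌φ))

  dead-end-¬D¬T : ∀ w → w ∋ □ ⊥' → ¬ AxD L × ¬ AxT L
  dead-end-¬D¬T w □⊥∈ = (λ d → ∋-D w d □⊥∈ (∋-thm w (nec (⇒-refl ⊥')))) , (λ t → ∌-⊥ w (∋-T w t □⊥∈))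

  data HasStatus (w : MCS) (φ : Fm) : Status → Set where
    is-necessary  : w ∋ □ φ → HasStatus w φ necessary
    is-impossible : w ∋ □ (¬' φ) → HasStatus w φ impossible
    is-contingent : w ∌ □ φ → w ∌ □ (¬' φ) → HasStatus w φ contingent

  classify : ∀ w φ → Σ Status (HasStatus w φ)
  classify w φ with em {w ∋ □ φ} | em {w ∋ □ (¬' φ)}
  ... | yes □φ∈ | _        = necessary  , is-necessary □φ∈
  ... | no ∌□φ  | yes □¬φ∈ = impossible , is-impossible □¬φ∈
  ... | no ∌□φ  | no ∌□¬φ  = contingent , is-contingent ∌□φ ∌□¬φ

  HasStatus-unique : ∀ {w φ s t} → w ∌ □ ⊥' → HasStatus w φ s → HasStatus w φ t → s ≡ t
  HasStatus-unique _        (is-necessary _)       (is-necessary _)       = refl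
  HasStatus-unique {w} live (is-necessary □φ∈)     (is-impossible □¬φ∈)   = ⊥-elim (live (□-⊥ w □φ∈ □¬φ∈))
  HasStatus-unique _        (is-necessary □φ∈)     (is-contingent ∌□φ _)  = ⊥-elim (∌□φ □φ∈)
  HasStatus-unique {w} live (is-impossible □¬φ∈)   (is-necessary □φ∈)     = ⊥-elim (live (□-⊥ w □φ∈ □¬φ∈))
  HasStatus-unique _        (is-impossible _)      (is-impossible _)      = refl
  HasStatus-unique _        (is-impossible □¬φ∈)   (is-contingent _ ∌□¬φ) = ⊥-elim (∌□¬φ □¬φ∈)
  HasStatus-unique _        (is-contingent ∌□φ _)  (is-necessary □φ∈)     = ⊥-elim (∌□φ □φ∈)
  HasStatus-unique _        (is-contingent _ ∌□¬φ) (is-impossible □¬φ∈)   = ⊥-elim (∌□¬φ □¬φ∈)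
  HasStatus-unique _        (is-contingent _ _)    (is-contingent _ _)    = refl

  ⇒-status : ∀ {w φ ψ s t} → HasStatus w φ s → HasStatus w ψ t → ∃ λ u → u ∈ s ⇒ˢ t × HasStatus w (φ ⇒ ψ) u
  ⇒-status {w} (is-impossible □¬φ∈) _ =
    necessary , here refl , is-necessary (□-lift₁ (λ u → ∋-⇒-by-¬antecedent u) w □¬φ∈)
  ⇒-status {w} (is-necessary _) (is-necessary □ψ∈) =
    necessary , here refl , is-necessary (□-lift₁ (λ u → ∋-⇒-by-consequent u) w □ψ∈)
  ⇒-status {w} (is-contingent _ _) (is-necessary □ψ∈) =
    necessary , here refl , is-necessary (□-lift₁ (λ u → ∋-⇒-by-consequent u) w □ψ∈)
  ⇒-status {w} (is-necessary □φ∈) (is-impossible □¬ψ∈) =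
    impossible , here refl , is-impossible (□-lift₂ (λ u → ∋-¬⇒⁺ u) w □φ∈ □¬ψ∈)
  ⇒-status {w} (is-necessary □φ∈) (is-contingent ∌□ψ ∌□¬ψ) =
    contingent , here refl ,
    is-contingent (λ □φ⇒ψ∈ → ∌□ψ (□-lift₂ (λ u → ∋-mp u) w □φ⇒ψ∈ □φ∈))
                  (λ □¬φ⇒ψ∈ → ∌□¬ψ (□-lift₁ (λ u → ∋-¬⇒⁻ʳ u) w □¬φ⇒ψ∈))
  ⇒-status {w} (is-contingent ∌□φ ∌□¬φ) (is-impossible □¬ψ∈) =
    contingent , here refl ,
    is-contingent (λ □φ⇒ψ∈ → ∌□¬φ (□-lift₂ (λ u → ∋-modus-tollens u) w □φ⇒ψ∈ □¬ψ∈))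
                  (λ □¬φ⇒ψ∈ → ∌□φ (□-lift₁ (λ u → ∋-¬⇒⁻ˡ u) w □¬φ⇒ψ∈))
  ⇒-status {w} {φ} {ψ} (is-contingent ∌□φ _) (is-contingent _ _) with em {w ∋ □ (φ ⇒ ψ)}
  ... | yes □φ⇒ψ∈ = necessary , here refl , is-necessary □φ⇒ψ∈
  ... | no ∌□φ⇒ψ  =
    contingent , there (here refl) ,
    is-contingent ∌□φ⇒ψ (λ □¬φ⇒ψ∈ → ∌□φ (□-lift₁ (λ u → ∋-¬⇒⁻ˡ u) w □¬φ⇒ψ∈))

  truth : MCS → Fm → Bool
  truth w φ = does (em {w ∋ φ})

  truth⁺ : ∀ w {φ} → w ∋ φ → T (truth w φ)
  truth⁺ w φ∈ = subst T (sym (dec-true em φ∈)) _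

  truth⁻ : ∀ w {φ} → T (truth w φ) → w ∋ φ
  truth⁻ w t = ∋-by-contradiction w (λ ∌φ → subst T (dec-false em ∌φ) t)

  truth-⊥ : ∀ w → truth w ⊥' ≡ false
  truth-⊥ w = dec-false em (∌-⊥ w)

  truth-⇒ : ∀ w φ ψ → truth w (φ ⇒ ψ) ≡ not (truth w φ) ∨ truth w ψ
  truth-⇒ w φ ψ = det (reflects-⇔ (∋-mp w) (∋-⇒⁺ w) (proof em)) (proof em →-reflects proof em)

  module Live (w : MCS) (live : w ∌ □ ⊥') where

    status : Fm → Status
    status φ = proj₁ (classify w φ)

    status-of : ∀ {φ s} → HasStatus w φ s → status φ ≡ s
    status-of {φ} = HasStatus-unique live (proj₂ (classify w φ))

    has-status : ∀ {φ s} → status φ ≡ s → HasStatus w φ s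
    has-status {φ} e = subst (HasStatus w φ) e (proj₂ (classify w φ))

    necessary⇒□ : ∀ {φ} → status φ ≡ necessary → w ∋ □ φ
    necessary⇒□ e with has-status e
    ... | is-necessary □φ∈ = □φ∈

    impossible⇒□¬ : ∀ {φ} → status φ ≡ impossible → w ∋ □ (¬' φ)
    impossible⇒□¬ e with has-status e
    ... | is-impossible □¬φ∈ = □¬φ∈

    contingent⇒∌□ : ∀ {φ} → status φ ≡ contingent → w ∌ □ φ × w ∌ □ (¬' φ)
    contingent⇒∌□ e with has-status e
    ... | is-contingent ∌□φ ∌□¬φ = ∌□φ , ∌□¬φ

    truth-□ : ∀ φ → truth w (□ φ) ≡ isNecessary (status φ)
    truth-□ φ =
      det (reflects-⇔ (status-of ∘ is-necessary) necessary⇒□ (proof em)) (isNecessary-reflects (status φ))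

    status-⊥ : status ⊥' ≡ impossible
    status-⊥ = status-of (is-impossible (∋-thm w (nec (⇒-refl ⊥'))))

    status-⇒ : ∀ φ ψ → status (φ ⇒ ψ) ∈ status φ ⇒ˢ status ψ
    status-⇒ φ ψ with ⇒-status (proj₂ (classify w φ)) (proj₂ (classify w ψ))
    ... | u , u∈ , has-u = subst (_∈ status φ ⇒ˢ status ψ) (sym (status-of has-u)) u∈

    admissible : Reflexive L → ∀ φ → Admissible (truth w φ) (status φ)
    admissible r φ =
      truth⁺ w ∘ ∋-reflexive r w live ∘ necessary⇒□ ,
      λ e → ∋-¬⁻ w (∋-reflexive r w live (impossible⇒□¬ e)) ∘ truth⁻ w

    box-laws : ∀ φ → BoxLaws L (truth w φ) (status φ) (status (□ φ))
    box-laws φ =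
        (λ ax → status-of ∘ is-necessary ∘ ∋-4 w ax ∘ necessary⇒□)
      , (λ ax ¬nec → status-of (is-impossible (∋-5 w ax (¬nec ∘ status-of ∘ is-necessary))))
      , (λ ax cont → proj₁ (contingent⇒∌□ cont) (∋-5′ ax w (proj₂ (contingent⇒∌□ cont))))
      , (λ ax ¬t → status-of (is-impossible (∋-B w ax (¬t ∘ truth⁺ w))))
      , (λ ax → status-of ∘ is-impossible ∘ ∋-□¬□ ax w ∘ impossible⇒□¬)
      , (λ r → admissible r φ , subst (λ i → Admissible i (status (□ φ))) (truth-□ φ) (admissible r (□ φ)))

    value : Fm → Val
    value φ = ⟨ truth w φ , status φ ⟩

    value-⊥ : value ⊥' ∈ bot~
    value-⊥ rewrite truth-⊥ w | status-⊥ = here refl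

    value-⇒ : ∀ φ ψ → value (φ ⇒ ψ) ∈ imp~ (value φ) (value ψ)
    value-⇒ φ ψ rewrite truth-⇒ w φ ψ = imp~-live _ _ _ _ _ (status-⇒ φ ψ)

    value-□ : ∀ φ → value (□ φ) ∈ box~ L (value φ)
    value-□ φ rewrite truth-□ φ = box~-live L _ _ _ (box-laws φ)

    valuation : Valuation L
    valuation = record
      { val   = value
      ; val-V = λ φ → VL-live L _ _ (λ r → admissible r φ)
      ; val-⊥ = value-⊥
      ; val-⇒ = value-⇒
      ; val-□ = value-□
      }

  module DeadEnd (w : MCS) (dead : w ∋ □ ⊥') where

    truth-□ : ∀ φ → truth w (□ φ) ≡ true
    truth-□ φ = dec-true em (□-lift₁ (λ u → ⊥-elim ∘ ∌-⊥ u) w dead)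

    value : Fm → Val
    value φ = dead-end (truth w φ)

    value-⊥ : value ⊥' ∈ bot~
    value-⊥ rewrite truth-⊥ w = there (here refl)

    value-⇒ : ∀ φ ψ → value (φ ⇒ ψ) ∈ imp~ (value φ) (value ψ)
    value-⇒ φ ψ rewrite truth-⇒ w φ ψ = imp~-dead-end _ _

    value-□ : ∀ φ → value (□ φ) ∈ box~ L (value φ)
    value-□ φ rewrite truth-□ φ = box~-dead-end L _ (dead-end-¬D¬T w dead)

    valuation : Valuation L
    valuation = record
      { val   = value
      ; val-V = λ φ → VL-dead-end L _ (dead-end-¬D¬T w dead)
      ; val-⊥ = value-⊥
      ; val-⇒ = value-⇒
      ; val-□ = value-□
      }

  canonical-by : ∀ w → Dec (w ∋ □ ⊥') → Valuation L
  canonical-by w (yes dead) = DeadEnd.valuation w dead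
  canonical-by w (no live)  = Live.valuation w live

  canonical : MCS → Valuation L
  canonical w = canonical-by w em

  designated-by : ∀ w d φ → Des (val (canonical-by w d) φ) → w ∋ φ
  designated-by w (yes _)   φ = truth⁻ w ∘ proj₁ (Des-dead-end (truth w φ))
  designated-by w (no live) φ = truth⁻ w ∘ proj₁ (Des-live (truth w φ) (Live.status w live φ))

  member-designated-by : ∀ w d φ → w ∋ φ → Des (val (canonical-by w d) φ)
  member-designated-by w (yes _)   φ = proj₂ (Des-dead-end (truth w φ)) ∘ truth⁺ w
  member-designated-by w (no live) φ = proj₂ (Des-live (truth w φ) (Live.status w live φ)) ∘ truth⁺ w

  level-zero-by : ∀ w d → Level L zero (canonical-by w d)
  level-zero-by w (yes _)   α _   β = dead-end-Two (truth w β)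
  level-zero-by w (no live) α two   = ⊥-elim (live-not-Two (truth w α) (Live.status w live α) two)

  theorem-top-by : ∀ w d {φ} → ⊢ φ → val (canonical-by w d) φ ∈ 𝐓 ∷ 𝐭₂ ∷ []
  theorem-top-by w (yes _) t rewrite dec-true em (∋-thm w t) = there (here refl)
  theorem-top-by w (no live) t
    rewrite dec-true em (∋-thm w t) | Live.status-of w live (is-necessary (∋-thm w (nec t))) = here refl

  canonical-level : ∀ w n → Level L n (canonical w)
  canonical-level w zero    = level-zero-by w em
  canonical-level w (suc n) = canonical-level w n , λ α valid-n →
    theorem-top-by w em (⊢-by-MCS λ u → designated-by u em α (valid-n (canonical u) (canonical-level u n)))

theorem2 : ExcludedMiddle 0ℓ →
           ∀ (L : Logic) (Γ : Pred Fm 0ℓ) (α : Fm) →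
           Γ ⊨[ L ] α → Γ ⊢[ L ] α
theorem2 em L Γ α ⊨α = decidable-stable em λ ⊬α →
  let w , Γ¬α⊆w = lindenbaum (Γ ∪ ｛ ¬' α ｝) (⊬α ∘ ⊢ₕ-finitary ∘ by-contradiction)
      Γ-designated = λ β → member-designated-by w em β ∘ Γ¬α⊆w ∘ inj₁
      α-designated = ⊨α (canonical w) (canonical-level w) Γ-designated
  in ∋-¬⁻ w (Γ¬α⊆w (inj₂ refl)) (designated-by w em α α-designated)
  where
  open Derivability L
  open CanonicalModel L em
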